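{- Let $q > r \ge 1$ be integers. If $S$ is a $K_q^r$-clique, then there exists an orthogonal $K_q^r$-booster for $S$.
   Context: An $r$-graph is identified with its edge set (a set of $r$-element subsets of its vertex set $V(G)$). $K_q^r$ is the complete $r$-graph on $q$ vertices, and a $K_q^r$-clique is an $r$-graph isomorphic to $K_q^r$. A $K_q^r$-decomposition of an $r$-graph $G$ is a partition of the edges of $G$ into $K_q^r$-cliques. For a $K_q^r$-decomposition $\mathcal{Q}$ of $G$ and an edge $e \in G$, $\mathcal{Q}[e]$ denotes the unique clique of $\mathcal{Q}$ containing $e$. A set $U$ of vertices is independent in an $r$-graph $B$ if no edge of $B$ is contained in $U$. A $K_q^r$-booster for a $K_q^r$-clique $S$ is an $r$-graph $B$ with $V(S) \subseteq V(B)$ such that $V(S)$ is independent in $B$, $B$ has a $K_q^r$-decomposition $\mathrm{Off}(B)$, and $B \cup S$ has a $K_q^r$-decomposition $\mathrm{On}(B)$ with $S \notin \mathrm{On}(B)$. Such a booster is orthogonal if, for some choice of these decompositions, $\mathrm{On}(B)[e] \neq \mathrm{On}(B)[f]$ for all distinct edges $e, f \in S$. -}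

module Defs where

open import Data.Nat using (ℕ; _<_)
open import Data.List using (List; length)
open import Data.List.Relation.Unary.Linked using (Linked)
open import Data.List.Relation.Unary.All using (All)
open import Data.List.Membership.Propositional using (_∈_)
open import Data.List.Relation.Binary.Subset.Propositional using (_⊆_)
open import Data.Product using (_×_; ∃-syntax; Σ-syntax)
open import Data.Sum using (_⊎_)
open import Relation.Binary.PropositionalEquality using (_≡_; _≢_)
open import Relation.Nullary using (¬_)
open import Data.Empty using (⊥)

-- Vertices are natural numbers.  A finite vertex set is represented canonically
-- as a strictly increasing list of naturals.
IsVSet : List ℕ → Set
IsVSet xs = Linked _<_ xs

IsRSet : ℕ → List ℕ → Set
IsRSet r e = IsVSet e × length e ≡ r

-- An r-graph is a finite set of edges, given as a list of r-sets
-- (membership semantics: the graph is the set of list members).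
IsRGraph : ℕ → List (List ℕ) → Set
IsRGraph r G = All (IsRSet r) G

InClique : ℕ → List ℕ → List ℕ → Set
InClique r X e = IsRSet r e × e ⊆ X

EdgePred : Set₁
EdgePred = List ℕ → Set

EdgesOf : List (List ℕ) → EdgePred
EdgesOf G e = e ∈ G

EdgesUnion : ℕ → List (List ℕ) → List ℕ → EdgePred
EdgesUnion r G X e = e ∈ G ⊎ InClique r X e

IsDecomposition : ℕ → ℕ → EdgePred → List (List ℕ) → Set
IsDecomposition r q E Q =
  All (λ Y → IsRSet q Y) Q
  × (∀ Y → Y ∈ Q → ∀ e → InClique r Y e → E e)
  × (∀ e → E e → ∃[ Y ] (Y ∈ Q × e ⊆ Y))
  × (∀ e → E e → ∀ Y Y' → Y ∈ Q → Y' ∈ Q → e ⊆ Y → e ⊆ Y' → Y ≡ Y')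

Independent : List (List ℕ) → List ℕ → Set
Independent B U = ∀ e → e ∈ B → ¬ (e ⊆ U)

IsOrthogonalBooster : ℕ → ℕ → List ℕ → List (List ℕ) → Set
IsOrthogonalBooster r q X B =
  IsRGraph r B
  × Independent B X
  × (∃[ Off ] IsDecomposition r q (EdgesOf B) Off)
  × (∃[ On ] ( IsDecomposition r q (EdgesUnion r B X) On
             × ¬ (X ∈ On)
             -- On[e] ≠ On[f] for distinct edges e, f of S
             × (∀ e f Y → InClique r X e → InClique r X f → e ≢ f
                  → Y ∈ On → e ⊆ Y → f ⊆ Y → ⊥)))

{-# OPTIONS --safe #-}
module Submission where

-- The booster lives on q columns, one for each vertex x of S, each holding m vertices of which
-- x itself has symbol 0; a function ρ choosing a symbol in every column spans the q-set row ρ,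
-- and the zero function spans V(S).  Take m = N! + 1 with N above every vertex of S, so that
-- differences of column labels are invertible modulo m.  Then modulo m a polynomial of degree
-- < r is determined by its values at any r columns, and a monic polynomial of degree r vanishes
-- at no r + 1 columns.  Hence the rows of the polynomials of degree < r, and also the rows of
-- the polynomials x^r + (degree < r), are K_q^r-decompositions of the complete q-partite
-- r-graph K on the columns; each row of one family agrees with a row of the other on any r
-- given columns C, because x^r - ∏_{a ∈ C} (x - a) has degree < r.  For B = K - S, Off(B) is
-- the first decomposition without the zero row, and On(B) is the second one, none of whose
-- cliques contains r + 1 vertices of S: so S ∉ On(B) and no clique of On(B) holds two edges of S.

open import Data.Nat.Base as ℕ using (ℕ; zero; suc; _<_; _≤_; s≤s; z≤n; NonZero; >-nonZero⁻¹; _!)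
import Data.Nat.Properties as ℕ
open import Data.Nat.DivMod using (_%_; [m+kn]%n≡m%n; m<n⇒m%n≡m)
open import Data.Nat.Divisibility using (>⇒∤; ∣1⇒≡1; ∣-trans; m∣m*n; m≤n⇒m!∣n!; ∣m+n∣m⇒∣n)
  renaming (_∣_ to _∣ℕ_)
open import Data.Nat.Coprimality using (Coprime)
open import Data.Integer.Base using (ℤ; +_; _+_; _*_; _-_; -_; _^_; 0ℤ; 1ℤ; ∣_∣; _%ℕ_; _/ℕ_)
import Data.Integer.Properties as ℤ
open import Data.Integer.DivMod using (a≡a%ℕn+[a/ℕn]*n; n%ℕd<d)
open import Data.Integer.Divisibility.Signed
  using (_∣_; divides; ∣⇒∣ᵤ; ∣ᵤ⇒∣; ∣m⇒∣-m; ∣m∣n⇒∣m+n; ∣m∣n⇒∣m-n; ∣n⇒∣m*n)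
open import Data.Integer.Coprimality using (coprime-divisor)
open import Data.Integer.Tactic.RingSolver using (solve-∀)
open import Data.List.Base
  using (List; []; _∷_; [_]; length; map; _++_; concatMap; filter; take; upTo; cartesianProductWith)
import Data.List.Properties as List
open import Data.List.Extrema.Nat using (max; xs≤max)
open import Data.List.Relation.Unary.Linked using (Linked; []; [-]; _∷_)
import Data.List.Relation.Unary.Linked.Properties as Linked
open import Data.List.Relation.Unary.AllPairs using (AllPairs; []; _∷_)
import Data.List.Relation.Unary.AllPairs as AllPairs
open import Data.List.Relation.Unary.All using (All; []; _∷_)
import Data.List.Relation.Unary.All as All
import Data.List.Relation.Unary.All.Properties as All
open import Data.List.Relation.Unary.Any using (here; there)
import Data.List.Relation.Unary.Any as Any
open import Data.List.Relation.Unary.Unique.Propositional using (Unique)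
import Data.List.Relation.Unary.Unique.Propositional.Properties as Unique
open import Data.List.Membership.Propositional using (_∈_; _∉_; find)
open import Data.List.Membership.Propositional.Properties
  using ( ∈-map⁺; ∈-map⁻; ∈-++⁺ˡ; ∈-++⁺ʳ; ∈-++⁻; ∈-concatMap⁺; ∈-concatMap⁻; ∈-filter⁺; ∈-filter⁻
        ; ∈-upTo⁺; ∈-cartesianProductWith⁺; ∈-cartesianProductWith⁻)
open import Data.List.Membership.DecPropositional ℕ._≟_ using (_∈?_)
open import Data.List.Relation.Binary.Subset.Propositional using (_⊆_)
open import Data.List.Relation.Binary.Subset.Propositional.Properties using (All-resp-⊇)
open import Data.List.Relation.Binary.Sublist.Propositional
  using ([]; _∷_; _∷ʳ_; minimum; lookup) renaming (_⊆_ to _⊑_)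
open import Data.List.Relation.Binary.Sublist.Propositional.Properties using (All-resp-⊆; to-≋; take-⊆)
open import Data.List.Relation.Binary.Pointwise using (Pointwise-≡⇒≡)
open import Data.List.Relation.Binary.Permutation.Propositional using (↭-sym; ↭⇒↭ₛ)
open import Data.List.Relation.Binary.Permutation.Propositional.Properties using (∈-resp-↭; ↭-length)
open import Data.List.Relation.Binary.Permutation.Setoid.Properties using (Unique-resp-↭)
open import Data.List.Sort ℕ.≤-decTotalOrder using (sort; sort-↭; sort-↗)
open import Data.Product.Base using (_×_; _,_; proj₁; proj₂; ∃-syntax)
open import Data.Sum.Base using (_⊎_; inj₁; inj₂)
open import Data.Empty using (⊥; ⊥-elim)
open import Function.Base using (_∘_)
open import Relation.Nullary using (¬_; Dec; yes; no)
open import Relation.Nullary.Decidable using (¬?)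
open import Relation.Binary.PropositionalEquality
  using (_≡_; _≢_; refl; sym; trans; cong; subst; setoid; module ≡-Reasoning)

open import Defs

-- Strictly increasing lists and their r-subsets

IsVSet⇒AllPairs : ∀ {xs} → IsVSet xs → AllPairs _<_ xs
IsVSet⇒AllPairs = Linked.Linked⇒AllPairs ℕ.<-trans

IsVSet⇒Unique : ∀ {xs} → IsVSet xs → Unique xs
IsVSet⇒Unique s = AllPairs.map ℕ.<⇒≢ (IsVSet⇒AllPairs s)

Linked≤∧Unique⇒IsVSet : ∀ {xs} → Linked _≤_ xs → Unique xs → IsVSet xs
Linked≤∧Unique⇒IsVSet [] _ = []
Linked≤∧Unique⇒IsVSet [-] _ = [-]
Linked≤∧Unique⇒IsVSet (x≤y ∷ l) ((x≢y ∷ _) ∷ u) = ℕ.≤∧≢⇒< x≤y x≢y ∷ Linked≤∧Unique⇒IsVSet l u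

sort-IsVSet : ∀ {xs} → Unique xs → IsVSet (sort xs)
sort-IsVSet {xs} u =
  Linked≤∧Unique⇒IsVSet (sort-↗ xs) (Unique-resp-↭ (setoid ℕ) (↭⇒↭ₛ (↭-sym (sort-↭ xs))) u)

⊑-AllPairs : ∀ {A : Set} {R : A → A → Set} {xs ys} → xs ⊑ ys → AllPairs R ys → AllPairs R xs
⊑-AllPairs [] _ = []
⊑-AllPairs (_ ∷ʳ τ) (_ ∷ rs) = ⊑-AllPairs τ rs
⊑-AllPairs (refl ∷ τ) (r ∷ rs) = All-resp-⊆ τ r ∷ ⊑-AllPairs τ rs

⊆⇒⊑ : ∀ {xs ys} → AllPairs _<_ xs → AllPairs _<_ ys → xs ⊆ ys → xs ⊑ ys
⊆⇒⊑ {[]} {ys} _ _ _ = minimum ys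
⊆⇒⊑ {x ∷ xs} {[]} _ _ sub with sub (here refl)
... | ()
⊆⇒⊑ {x ∷ xs} {y ∷ ys} sx@(x< ∷ sxs) (y< ∷ sys) sub with sub (here refl)
... | here refl = refl ∷ ⊆⇒⊑ sxs sys tail⊆
  where
  tail⊆ : xs ⊆ ys
  tail⊆ z∈xs with sub (there z∈xs)
  ... | here refl = ⊥-elim (ℕ.<-irrefl refl (All.lookup x< z∈xs))
  ... | there z∈ys = z∈ys
... | there x∈ys = y ∷ʳ ⊆⇒⊑ sx sys ⊆tail
  where
  ⊆tail : x ∷ xs ⊆ ys
  ⊆tail (here refl) = x∈ys
  ⊆tail (there z∈xs) with sub (there z∈xs)
  ... | here refl = ⊥-elim (ℕ.<-asym (All.lookup y< x∈ys) (All.lookup x< z∈xs))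
  ... | there z∈ys = z∈ys

⊆∧length≡⇒≡ : ∀ {xs ys} → IsVSet xs → IsVSet ys → xs ⊆ ys → length xs ≡ length ys → xs ≡ ys
⊆∧length≡⇒≡ sxs sys xs⊆ys eq =
  Pointwise-≡⇒≡ (to-≋ eq (⊆⇒⊑ (IsVSet⇒AllPairs sxs) (IsVSet⇒AllPairs sys) xs⊆ys))

choose : ∀ {A : Set} → ℕ → List A → List (List A)
choose zero ys = [ [] ]
choose (suc k) [] = []
choose (suc k) (y ∷ ys) = map (y ∷_) (choose k ys) ++ choose (suc k) ys

∈-choose⁻ : ∀ {A : Set} k (ys : List A) {xs} → xs ∈ choose k ys → xs ⊑ ys × length xs ≡ k
∈-choose⁻ zero ys (here refl) = minimum ys , refl
∈-choose⁻ (suc k) (y ∷ ys) xs∈ with ∈-++⁻ (map (y ∷_) (choose k ys)) xs∈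
... | inj₂ xs∈ʳ = let τ , len = ∈-choose⁻ (suc k) ys xs∈ʳ in y ∷ʳ τ , len
... | inj₁ xs∈ˡ with ∈-map⁻ (y ∷_) xs∈ˡ
... | xs′ , xs′∈ , refl = let τ , len = ∈-choose⁻ k ys xs′∈ in refl ∷ τ , cong suc len

∈-choose⁺ : ∀ {A : Set} {xs ys : List A} → xs ⊑ ys → xs ∈ choose (length xs) ys
∈-choose⁺ [] = here refl
∈-choose⁺ {xs = []} (y ∷ʳ τ) = here refl
∈-choose⁺ {xs = _ ∷ _} (y ∷ʳ τ) = ∈-++⁺ʳ _ (∈-choose⁺ τ)
∈-choose⁺ (refl ∷ τ) = ∈-++⁺ˡ (∈-map⁺ _ (∈-choose⁺ τ))

⊆⊎∉ : (xs ys : List ℕ) → xs ⊆ ys ⊎ ∃[ v ] v ∈ xs × v ∉ ys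
⊆⊎∉ xs ys with All.all? (_∈? ys) xs
... | yes all∈ = inj₁ (All.lookup all∈)
... | no ¬all∈ = inj₂ (find (All.¬All⇒Any¬ (_∈? ys) xs ¬all∈))

cliqueUnion : ℕ → List (List ℕ) → List (List ℕ)
cliqueUnion r = concatMap (choose r)

∈-cliqueUnion⁺ : ∀ {r Q Y e} → IsVSet Y → Y ∈ Q → InClique r Y e → e ∈ cliqueUnion r Q
∈-cliqueUnion⁺ {r} {Y = Y} {e} sY Y∈Q ((se , len) , e⊆Y) =
  ∈-concatMap⁺ (choose r) (Any.map (λ { refl → e∈ }) Y∈Q)
  where
  e∈ : e ∈ choose r Y
  e∈ = subst (λ k → e ∈ choose k Y) len (∈-choose⁺ (⊆⇒⊑ (IsVSet⇒AllPairs se) (IsVSet⇒AllPairs sY) e⊆Y))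

∈-cliqueUnion⁻ : ∀ {r Q e} → All IsVSet Q → e ∈ cliqueUnion r Q → ∃[ Y ] Y ∈ Q × InClique r Y e
∈-cliqueUnion⁻ {r} {Q} sQ e∈ with find (∈-concatMap⁻ (choose r) {xs = Q} e∈)
... | Y , Y∈Q , e∈Y with ∈-choose⁻ r Y e∈Y
... | τ , len =
  Y , Y∈Q , (Linked.AllPairs⇒Linked (⊑-AllPairs τ (IsVSet⇒AllPairs (All.lookup sQ Y∈Q))) , len) , lookup τ

-- Rows of column functions, and the booster spanned by two families of rows

IsDecomposition-resp : ∀ {r q} {E E′ : EdgePred} {Q} → (∀ {e} → E e → E′ e) → (∀ {e} → E′ e → E e)
  → IsDecomposition r q E Q → IsDecomposition r q E′ Q
IsDecomposition-resp to from (cliques , sound , cover , unique) =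
  cliques , (λ Y Y∈Q e e∈Y → to (sound Y Y∈Q e e∈Y)) , (λ e → cover e ∘ from) , (λ e → unique e ∘ from)

bound : List ℕ → ℕ
bound X = suc (max 0 X)

∈⇒<bound : ∀ {x X} → x ∈ X → x < bound X
∈⇒<bound {X = X} x∈X = s≤s (All.lookup (xs≤max 0 X) x∈X)

Agree : (ℕ → ℕ) → (ℕ → ℕ) → List ℕ → Set
Agree ρ ρ′ C = All (λ x → ρ x ≡ ρ′ x) C

Vanishes : (ℕ → ℕ) → List ℕ → Set
Vanishes ρ C = All (λ x → ρ x ≡ 0) C

Vanishes⇒Agree : ∀ {ρ ρ′ C} → Vanishes ρ C → Vanishes ρ′ C → Agree ρ ρ′ C
Vanishes⇒Agree ρ≡0 ρ′≡0 = All.zipWith (λ (ρx≡0 , ρ′x≡0) → trans ρx≡0 (sym ρ′x≡0)) (ρ≡0 , ρ′≡0)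

IsColumnSet : List ℕ → ℕ → List ℕ → Set
IsColumnSet X k C = Unique C × length C ≡ k × C ⊆ X

Packing : List ℕ → ℕ → List (ℕ → ℕ) → Set
Packing X r F = ∀ {ρ ρ′ C} → ρ ∈ F → ρ′ ∈ F → IsColumnSet X r C → Agree ρ ρ′ C → ∀ x → ρ x ≡ ρ′ x

Matching : List ℕ → ℕ → List (ℕ → ℕ) → List (ℕ → ℕ) → Set
Matching X r F G = ∀ {ρ C} → ρ ∈ F → IsColumnSet X r C → ∃[ ρ′ ] ρ′ ∈ G × Agree ρ ρ′ C

Packing-mono : ∀ {X r F G} → F ⊆ G → Packing X r G → Packing X r F
Packing-mono F⊆G packing ρ∈F ρ′∈F = packing (F⊆G ρ∈F) (F⊆G ρ′∈F)

record BoosterDesign (X : List ℕ) (r : ℕ) : Set where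
  field
    off on : List (ℕ → ℕ)
    zeroRow : ∃[ ρ ] ρ ∈ off × Vanishes ρ X
    off-packing : Packing X r off
    on-packing : Packing X r on
    off⇒on : Matching X r off on
    on⇒off : Matching X r on off
    on-nonvanishing : ∀ {ρ C} → ρ ∈ on → IsColumnSet X (suc r) C → ¬ Vanishes ρ C

module Rows (r q : ℕ) {X : List ℕ} (X-set : IsRSet q X) where

  N : ℕ
  N = bound X

  vertex : ℕ → ℕ → ℕ
  vertex x s = s ℕ.* N ℕ.+ x

  vertex-injective : ∀ {x y} s t → x < N → y < N → vertex x s ≡ vertex y t → x ≡ y × s ≡ t
  vertex-injective {x} {y} s t x<N y<N eq =
    x≡y
    , ℕ.*-cancelʳ-≡ s t N (ℕ.+-cancelʳ-≡ y (s ℕ.* N) (t ℕ.* N) (subst (λ z → vertex z s ≡ vertex y t) x≡y eq))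
    where
    open ≡-Reasoning
    x≡y : x ≡ y
    x≡y = begin
      x                      ≡⟨ m<n⇒m%n≡m x<N ⟨
      x % N                  ≡⟨ [m+kn]%n≡m%n x s N ⟨
      (x ℕ.+ s ℕ.* N) % N    ≡⟨ cong (_% N) (trans (ℕ.+-comm x (s ℕ.* N)) (trans eq (ℕ.+-comm (t ℕ.* N) y))) ⟩
      (y ℕ.+ t ℕ.* N) % N    ≡⟨ [m+kn]%n≡m%n y t N ⟩
      y % N                  ≡⟨ m<n⇒m%n≡m y<N ⟩
      y                      ∎

  cell : (ℕ → ℕ) → ℕ → ℕ
  cell ρ x = vertex x (ρ x)

  cell-injective : ∀ ρ ρ′ {x y} → x ∈ X → y ∈ X → cell ρ x ≡ cell ρ′ y → x ≡ y × ρ x ≡ ρ′ y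
  cell-injective ρ ρ′ x∈X y∈X = vertex-injective (ρ _) (ρ′ _) (∈⇒<bound x∈X) (∈⇒<bound y∈X)

  row : (ℕ → ℕ) → List ℕ
  row ρ = sort (map (cell ρ) X)

  ∈-row⁻ : ∀ ρ {v} → v ∈ row ρ → ∃[ x ] x ∈ X × v ≡ cell ρ x
  ∈-row⁻ ρ v∈row = ∈-map⁻ (cell ρ) (∈-resp-↭ (sort-↭ (map (cell ρ) X)) v∈row)

  ∈-row⁺ : ∀ ρ {x} → x ∈ X → cell ρ x ∈ row ρ
  ∈-row⁺ ρ x∈X = ∈-resp-↭ (↭-sym (sort-↭ (map (cell ρ) X))) (∈-map⁺ (cell ρ) x∈X)

  Unique-map-cell : ∀ ρ {C} → C ⊆ X → Unique C → Unique (map (cell ρ) C)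
  Unique-map-cell ρ {[]} _ [] = []
  Unique-map-cell ρ {x ∷ C} C⊆X (x∉C ∷ uC) =
    All.map⁺ (All.tabulate λ y∈C eq →
      All.lookup x∉C y∈C (proj₁ (cell-injective ρ ρ (C⊆X (here refl)) (C⊆X (there y∈C)) eq)))
    ∷ Unique-map-cell ρ (C⊆X ∘ there) uC

  row-IsRSet : ∀ ρ → IsRSet q (row ρ)
  row-IsRSet ρ = sort-IsVSet (Unique-map-cell ρ (λ x∈X → x∈X) (IsVSet⇒Unique (proj₁ X-set)))
    , trans (↭-length (sort-↭ _)) (trans (List.length-map (cell ρ) X) (proj₂ X-set))

  row-cong : ∀ {ρ ρ′} → (∀ x → ρ x ≡ ρ′ x) → row ρ ≡ row ρ′
  row-cong ρ≗ρ′ = cong sort (List.map-cong (λ x → cong (vertex x) (ρ≗ρ′ x)) X)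

  ⊆-row⇒columns : ∀ ρ {e} → e ⊆ row ρ → ∃[ C ] C ⊆ X × e ≡ map (cell ρ) C
  ⊆-row⇒columns ρ {[]} _ = [] , (λ ()) , refl
  ⊆-row⇒columns ρ {v ∷ e} v∷e⊆row with ∈-row⁻ ρ (v∷e⊆row (here refl)) | ⊆-row⇒columns ρ (v∷e⊆row ∘ there)
  ... | x , x∈X , refl | C , C⊆X , refl = x ∷ C , (λ { (here refl) → x∈X ; (there y∈C) → C⊆X y∈C }) , refl

  ⊆-row⇒columnSet : ∀ ρ {k e} → IsRSet k e → e ⊆ row ρ → ∃[ C ] IsColumnSet X k C × e ≡ map (cell ρ) C
  ⊆-row⇒columnSet ρ (se , len) e⊆row with ⊆-row⇒columns ρ e⊆row
  ... | C , C⊆X , refl =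
    C , (Unique.map⁻ (IsVSet⇒Unique se) , trans (sym (List.length-map (cell ρ) C)) len , C⊆X) , refl

  ⊆-row⇒Agree : ∀ ρ ρ′ {C} → C ⊆ X → map (cell ρ) C ⊆ row ρ′ → Agree ρ ρ′ C
  ⊆-row⇒Agree ρ ρ′ C⊆X cells⊆row = All.tabulate λ x∈C →
    let y , y∈X , eq = ∈-row⁻ ρ′ (cells⊆row (∈-map⁺ (cell ρ) x∈C))
        x≡y , ρx≡ρ′y = cell-injective ρ ρ′ (C⊆X x∈C) y∈X eq
    in trans ρx≡ρ′y (cong ρ′ (sym x≡y))

  Agree⇒⊆-row : ∀ ρ ρ′ {C} → C ⊆ X → Agree ρ ρ′ C → map (cell ρ) C ⊆ row ρ′
  Agree⇒⊆-row ρ ρ′ C⊆X agree v∈cells with ∈-map⁻ (cell ρ) v∈cells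
  ... | x , x∈C , refl = subst (_∈ row ρ′) (cong (vertex x) (sym (All.lookup agree x∈C))) (∈-row⁺ ρ′ (C⊆X x∈C))

  cell∈X⇒0 : ∀ ρ {x} → x ∈ X → cell ρ x ∈ X → ρ x ≡ 0
  cell∈X⇒0 ρ {x} x∈X cell∈X = proj₂ (vertex-injective (ρ x) 0 (∈⇒<bound x∈X) (∈⇒<bound cell∈X) refl)

  Vanishes⇒row⊆X : ∀ ρ → Vanishes ρ X → row ρ ⊆ X
  Vanishes⇒row⊆X ρ ρ≡0 v∈row with ∈-row⁻ ρ v∈row
  ... | x , x∈X , refl = subst (_∈ X) (cong (vertex x) (sym (All.lookup ρ≡0 x∈X))) x∈X

  Vanishes⇒X⊆row : ∀ ρ → Vanishes ρ X → X ⊆ row ρ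
  Vanishes⇒X⊆row ρ ρ≡0 {x} x∈X = subst (_∈ row ρ) (cong (vertex x) (All.lookup ρ≡0 x∈X)) (∈-row⁺ ρ x∈X)

  row⊆X⇒Vanishes : ∀ ρ → row ρ ⊆ X → Vanishes ρ X
  row⊆X⇒Vanishes ρ row⊆X = All.tabulate λ x∈X → cell∈X⇒0 ρ x∈X (row⊆X (∈-row⁺ ρ x∈X))

  cells⊆X⇒Vanishes : ∀ ρ {C} → C ⊆ X → map (cell ρ) C ⊆ X → Vanishes ρ C
  cells⊆X⇒Vanishes ρ C⊆X cells⊆X =
    All.tabulate λ x∈C → cell∈X⇒0 ρ (C⊆X x∈C) (cells⊆X (∈-map⁺ (cell ρ) x∈C))

  take-IsColumnSet : ∀ {k} → k ≤ q → IsColumnSet X k (take k X)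
  take-IsColumnSet {k} k≤q =
    Unique.take⁺ k (IsVSet⇒Unique (proj₁ X-set))
    , trans (List.length-take k X) (ℕ.m≤n⇒m⊓n≡m (subst (k ≤_) (sym (proj₂ X-set)) k≤q))
    , lookup (take-⊆ k X)

  two-edges⇒vanishing : ∀ ρ {e f} → InClique r X e → InClique r X f → e ≢ f → e ⊆ row ρ → f ⊆ row ρ
    → ∃[ C ] IsColumnSet X (suc r) C × Vanishes ρ C
  two-edges⇒vanishing ρ {e} {f} (re , e⊆X) (rf , f⊆X) e≢f e⊆row f⊆row with ⊆⊎∉ f e
  ... | inj₁ f⊆e =
    ⊥-elim (e≢f (sym (⊆∧length≡⇒≡ (proj₁ rf) (proj₁ re) f⊆e (trans (proj₂ rf) (sym (proj₂ re))))))
  ... | inj₂ (v , v∈f , v∉e) with ∈-row⁻ ρ (f⊆row v∈f) | ⊆-row⇒columnSet ρ re e⊆row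
  ... | x , x∈X , refl | C , (uC , lenC , C⊆X) , refl =
    x ∷ C , (x∉C ∷ uC , cong suc lenC , x∷C⊆X) , cell∈X⇒0 ρ x∈X (f⊆X v∈f) ∷ cells⊆X⇒Vanishes ρ C⊆X e⊆X
    where
    x∉C : All (x ≢_) C
    x∉C = All.tabulate λ y∈C x≡y →
      v∉e (subst (λ z → cell ρ z ∈ map (cell ρ) C) (sym x≡y) (∈-map⁺ (cell ρ) y∈C))
    x∷C⊆X : x ∷ C ⊆ X
    x∷C⊆X (here refl) = x∈X
    x∷C⊆X (there y∈C) = C⊆X y∈C

  Covered : List (ℕ → ℕ) → EdgePred
  Covered F e = IsRSet r e × ∃[ ρ ] ρ ∈ F × e ⊆ row ρ

  Covered-mono : ∀ {F G e} → F ⊆ G → Covered F e → Covered G e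
  Covered-mono F⊆G (re , ρ , ρ∈F , e⊆row) = re , ρ , F⊆G ρ∈F , e⊆row

  Covered-transfer : ∀ {F G e} → Matching X r F G → Covered F e → Covered G e
  Covered-transfer match (re , ρ , ρ∈F , e⊆row) with ⊆-row⇒columnSet ρ re e⊆row
  ... | C , C-set , refl =
    let ρ′ , ρ′∈G , agree = match ρ∈F C-set
    in re , ρ′ , ρ′∈G , Agree⇒⊆-row ρ ρ′ (proj₂ (proj₂ C-set)) agree

  rows-decompose : ∀ {F} → Packing X r F → IsDecomposition r q (Covered F) (map row F)
  rows-decompose {F} packing = All.map⁺ (All.tabulate λ {ρ} _ → row-IsRSet ρ) , sound , cover , unique
    where
    sound : ∀ Y → Y ∈ map row F → ∀ e → InClique r Y e → Covered F e
    sound Y Y∈ e (re , e⊆Y) with ∈-map⁻ row Y∈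
    ... | ρ , ρ∈F , refl = re , ρ , ρ∈F , e⊆Y
    cover : ∀ e → Covered F e → ∃[ Y ] Y ∈ map row F × e ⊆ Y
    cover e (_ , ρ , ρ∈F , e⊆row) = row ρ , ∈-map⁺ row ρ∈F , e⊆row
    unique : ∀ e → Covered F e → ∀ Y Y′ → Y ∈ map row F → Y′ ∈ map row F → e ⊆ Y → e ⊆ Y′ → Y ≡ Y′
    unique e (re , _) Y Y′ Y∈ Y′∈ e⊆Y e⊆Y′ with ∈-map⁻ row Y∈ | ∈-map⁻ row Y′∈
    ... | ρ , ρ∈F , refl | ρ′ , ρ′∈F , refl with ⊆-row⇒columnSet ρ re e⊆Y
    ... | C , C-set , refl =
      row-cong (packing ρ∈F ρ′∈F C-set (⊆-row⇒Agree ρ ρ′ (proj₂ (proj₂ C-set)) e⊆Y′))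

  module Construction (design : BoosterDesign X r) where
    open BoosterDesign design

    vanishes? : ∀ ρ → Dec (Vanishes ρ X)
    vanishes? ρ = All.all? (λ x → ρ x ℕ.≟ 0) X

    nonzero : List (ℕ → ℕ)
    nonzero = filter (¬? ∘ vanishes?) off

    nonzero⊆off : nonzero ⊆ off
    nonzero⊆off = proj₁ ∘ ∈-filter⁻ (¬? ∘ vanishes?)

    offCliques onCliques B : List (List ℕ)
    offCliques = map row nonzero
    onCliques = map row on
    B = cliqueUnion r offCliques

    B⇒Covered : ∀ {e} → e ∈ B → Covered nonzero e
    B⇒Covered e∈B with ∈-cliqueUnion⁻ (All.map⁺ (All.tabulate λ {ρ} _ → proj₁ (row-IsRSet ρ))) e∈B
    ... | Y , Y∈ , re , e⊆Y with ∈-map⁻ row Y∈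
    ... | ρ , ρ∈ , refl = re , ρ , ρ∈ , e⊆Y

    Covered⇒B : ∀ {e} → Covered nonzero e → e ∈ B
    Covered⇒B (re , ρ , ρ∈ , e⊆row) = ∈-cliqueUnion⁺ (proj₁ (row-IsRSet ρ)) (∈-map⁺ row ρ∈) (re , e⊆row)

    Union⇒Covered : ∀ {e} → EdgesUnion r B X e → Covered on e
    Union⇒Covered (inj₁ e∈B) = Covered-transfer off⇒on (Covered-mono nonzero⊆off (B⇒Covered e∈B))
    Union⇒Covered (inj₂ (re , e⊆X)) =
      let ρ₀ , ρ₀∈off , ρ₀≡0 = zeroRow
      in Covered-transfer off⇒on (re , ρ₀ , ρ₀∈off , Vanishes⇒X⊆row ρ₀ ρ₀≡0 ∘ e⊆X)

    Covered⇒Union : ∀ {e} → Covered on e → EdgesUnion r B X e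
    Covered⇒Union covered with Covered-transfer on⇒off covered
    ... | re , ρ , ρ∈off , e⊆row with vanishes? ρ
    ... | yes ρ≡0 = inj₂ (re , Vanishes⇒row⊆X ρ ρ≡0 ∘ e⊆row)
    ... | no ρ≢0 = inj₁ (Covered⇒B (re , ρ , ∈-filter⁺ (¬? ∘ vanishes?) ρ∈off ρ≢0 , e⊆row))

    independent : Independent B X
    independent e e∈B e⊆X with B⇒Covered e∈B | zeroRow
    ... | re , ρ , ρ∈ , e⊆row | ρ₀ , ρ₀∈off , ρ₀≡0 with ⊆-row⇒columnSet ρ re e⊆row
    ... | C , C-set@(_ , _ , C⊆X) , refl =
      proj₂ (∈-filter⁻ (¬? ∘ vanishes?) {xs = off} ρ∈)
        (All.tabulate λ {x} x∈X → trans (ρ≗ρ₀ x) (All.lookup ρ₀≡0 x∈X))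
      where
      ρ≗ρ₀ : ∀ x → ρ x ≡ ρ₀ x
      ρ≗ρ₀ = off-packing (nonzero⊆off ρ∈) ρ₀∈off C-set
        (Vanishes⇒Agree (cells⊆X⇒Vanishes ρ C⊆X e⊆X) (All-resp-⊇ C⊆X ρ₀≡0))

    X∉onCliques : r < q → ¬ (X ∈ onCliques)
    X∉onCliques r<q X∈ with ∈-map⁻ row X∈
    ... | ρ , ρ∈on , X≡row = on-nonvanishing ρ∈on C-set (All-resp-⊇ C⊆X (row⊆X⇒Vanishes ρ row⊆X))
      where
      C-set : IsColumnSet X (suc r) (take (suc r) X)
      C-set = take-IsColumnSet r<q
      C⊆X : take (suc r) X ⊆ X
      C⊆X = proj₂ (proj₂ C-set)
      row⊆X : row ρ ⊆ X
      row⊆X {v} v∈row = subst (v ∈_) (sym X≡row) v∈row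

    orthogonal : ∀ e f Y → InClique r X e → InClique r X f → e ≢ f → Y ∈ onCliques → e ⊆ Y → f ⊆ Y → ⊥
    orthogonal e f Y e∈S f∈S e≢f Y∈ e⊆Y f⊆Y with ∈-map⁻ row Y∈
    ... | ρ , ρ∈on , refl = let C , C-set , ρC≡0 = two-edges⇒vanishing ρ e∈S f∈S e≢f e⊆Y f⊆Y
                            in on-nonvanishing ρ∈on C-set ρC≡0

    booster : r < q → ∃[ B ] IsOrthogonalBooster r q X B
    booster r<q =
      B , All.tabulate (proj₁ ∘ B⇒Covered) , independent
      , (offCliques
        , IsDecomposition-resp Covered⇒B B⇒Covered (rows-decompose (Packing-mono nonzero⊆off off-packing)))
      , (onCliques
        , IsDecomposition-resp Covered⇒Union Union⇒Covered (rows-decompose on-packing)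
        , X∉onCliques r<q
        , orthogonal)

-- Integer polynomials as coefficient lists, constant term first

eval : List ℤ → ℤ → ℤ
eval [] x = 0ℤ
eval (p ∷ P) x = p + x * eval P x

toℤ : List ℕ → List ℤ
toℤ = map (λ n → + n)

length-toℤ : ∀ C → length (toℤ C) ≡ length C
length-toℤ = List.length-map (λ n → + n)

∈-toℤ⁺ : ∀ {c C} → c ∈ C → + c ∈ toℤ C
∈-toℤ⁺ = ∈-map⁺ (λ n → + n)

infixl 6 _+ₚ_ _-ₚ_
infixr 7 _·ₚ_

_+ₚ_ : List ℤ → List ℤ → List ℤ
[] +ₚ Q = Q
(p ∷ P) +ₚ [] = p ∷ P
(p ∷ P) +ₚ (q ∷ Q) = (p + q) ∷ (P +ₚ Q)

_·ₚ_ : ℤ → List ℤ → List ℤ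
a ·ₚ P = map (a *_) P

_-ₚ_ : List ℤ → List ℤ → List ℤ
P -ₚ Q = P +ₚ (- 1ℤ) ·ₚ Q

eval-+ₚ : ∀ P Q x → eval (P +ₚ Q) x ≡ eval P x + eval Q x
eval-+ₚ [] Q x = sym (ℤ.+-identityˡ _)
eval-+ₚ (p ∷ P) [] x = sym (ℤ.+-identityʳ _)
eval-+ₚ (p ∷ P) (q ∷ Q) x rewrite eval-+ₚ P Q x = identity p q x (eval P x) (eval Q x)
  where
  identity : ∀ p q x u v → (p + q) + x * (u + v) ≡ (p + x * u) + (q + x * v)
  identity = solve-∀

eval-·ₚ : ∀ a P x → eval (a ·ₚ P) x ≡ a * eval P x
eval-·ₚ a [] x = sym (ℤ.*-zeroʳ a)
eval-·ₚ a (p ∷ P) x rewrite eval-·ₚ a P x = identity a p x (eval P x)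
  where
  identity : ∀ a p x u → a * p + x * (a * u) ≡ a * (p + x * u)
  identity = solve-∀

eval--ₚ : ∀ P Q x → eval (P -ₚ Q) x ≡ eval P x - eval Q x
eval--ₚ P Q x rewrite eval-+ₚ P ((- 1ℤ) ·ₚ Q) x | eval-·ₚ (- 1ℤ) Q x = identity (eval P x) (eval Q x)
  where
  identity : ∀ u v → u + (- 1ℤ) * v ≡ u - v
  identity = solve-∀

length-+ₚ : ∀ {k} P Q → length P ≤ k → length Q ≤ k → length (P +ₚ Q) ≤ k
length-+ₚ [] Q _ lQ = lQ
length-+ₚ (p ∷ P) [] lP _ = lP
length-+ₚ (p ∷ P) (q ∷ Q) (s≤s lP) (s≤s lQ) = s≤s (length-+ₚ P Q lP lQ)

length-·ₚ : ∀ {k} a P → length P ≤ k → length (a ·ₚ P) ≤ k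
length-·ₚ a P = subst (_≤ _) (sym (List.length-map (a *_) P))

length--ₚ : ∀ {k} P Q → length P ≤ k → length Q ≤ k → length (P -ₚ Q) ≤ k
length--ₚ P Q lP lQ = length-+ₚ P ((- 1ℤ) ·ₚ Q) lP (length-·ₚ (- 1ℤ) Q lQ)

divLinear : ℤ → List ℤ → List ℤ
divLinear a [] = []
divLinear a (p ∷ P) = P +ₚ a ·ₚ divLinear a P

eval-divLinear : ∀ a P x → eval P x ≡ eval P a + (x - a) * eval (divLinear a P) x
eval-divLinear a [] x = sym (trans (ℤ.+-identityˡ _) (ℤ.*-zeroʳ (x - a)))
eval-divLinear a (p ∷ P) x
  rewrite eval-+ₚ P (a ·ₚ divLinear a P) x | eval-·ₚ a (divLinear a P) x | eval-divLinear a P x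
  = identity p x a (eval P a) (eval (divLinear a P) x)
  where
  identity : ∀ p x a u d → p + x * (u + (x - a) * d) ≡ (p + a * u) + (x - a) * ((u + (x - a) * d) + a * d)
  identity = solve-∀

length-divLinear : ∀ {k} a P → length P ≤ suc k → length (divLinear a P) ≤ k
length-divLinear a [] _ = z≤n
length-divLinear a (p ∷ P) (s≤s lP) =
  length-+ₚ P (a ·ₚ divLinear a P) lP (length-·ₚ a (divLinear a P) (length-divLinear a P (ℕ.m≤n⇒m≤1+n lP)))

nodeProduct : List ℤ → ℤ → ℤ
nodeProduct [] x = 1ℤ
nodeProduct (a ∷ A) x = (x - a) * nodeProduct A x

nodeProduct-root : ∀ {a} A → a ∈ A → nodeProduct A a ≡ 0ℤ
nodeProduct-root {a} (a ∷ A) (here refl) =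
  trans (cong (_* nodeProduct A a) (ℤ.+-inverseʳ a)) (ℤ.*-zeroˡ (nodeProduct A a))
nodeProduct-root {a} (b ∷ A) (there a∈A) =
  trans (cong ((a - b) *_) (nodeProduct-root A a∈A)) (ℤ.*-zeroʳ (a - b))

monomial : ℕ → ℤ → List ℤ
monomial zero c = [ c ]
monomial (suc k) c = 0ℤ ∷ monomial k c

eval-monomial : ∀ k c x → eval (monomial k c) x ≡ c * x ^ k
eval-monomial zero c x = identity c x
  where
  identity : ∀ c x → c + x * 0ℤ ≡ c * 1ℤ
  identity = solve-∀
eval-monomial (suc k) c x rewrite eval-monomial k c x = identity c x (x ^ k)
  where
  identity : ∀ c x y → 0ℤ + x * (c * y) ≡ c * (x * y)
  identity = solve-∀

length-monomial : ∀ k c → length (monomial k c) ≡ suc k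
length-monomial zero c = refl
length-monomial (suc k) c = cong suc (length-monomial k c)

nodeLower : List ℤ → List ℤ
nodeLower [] = []
nodeLower (a ∷ A) = (0ℤ ∷ nodeLower A) +ₚ ((- a) ·ₚ nodeLower A +ₚ monomial (length A) (- a))

eval-nodeLower : ∀ A x → eval (nodeLower A) x + x ^ length A ≡ nodeProduct A x
eval-nodeLower [] x = refl
eval-nodeLower (a ∷ A) x
  rewrite eval-+ₚ (0ℤ ∷ nodeLower A) ((- a) ·ₚ nodeLower A +ₚ monomial (length A) (- a)) x
        | eval-+ₚ ((- a) ·ₚ nodeLower A) (monomial (length A) (- a)) x
        | eval-·ₚ (- a) (nodeLower A) x
        | eval-monomial (length A) (- a) x
        | sym (eval-nodeLower A x)
  = identity x a (eval (nodeLower A) x) (x ^ length A)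
  where
  identity : ∀ x a l y → ((0ℤ + x * l) + ((- a) * l + (- a) * y)) + x * y ≡ (x - a) * (l + y)
  identity = solve-∀

length-nodeLower : ∀ A → length (nodeLower A) ≤ length A
length-nodeLower [] = z≤n
length-nodeLower (a ∷ A) =
  length-+ₚ (0ℤ ∷ nodeLower A) ((- a) ·ₚ nodeLower A +ₚ monomial (length A) (- a)) (s≤s (length-nodeLower A))
    (length-+ₚ ((- a) ·ₚ nodeLower A) (monomial (length A) (- a))
      (length-·ₚ (- a) (nodeLower A) (ℕ.m≤n⇒m≤1+n (length-nodeLower A)))
      (ℕ.≤-reflexive (length-monomial (length A) (- a))))

eval-+nodeLower : ∀ {r} A → length A ≡ r → ∀ P x
  → eval (P +ₚ nodeLower A) x + x ^ r ≡ eval P x + nodeProduct A x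
eval-+nodeLower A refl P x rewrite eval-+ₚ P (nodeLower A) x | sym (eval-nodeLower A x) =
  identity (eval P x) (eval (nodeLower A) x) (x ^ length A)
  where
  identity : ∀ p l y → (p + l) + y ≡ p + (l + y)
  identity = solve-∀

eval--nodeLower : ∀ {r} A → length A ≡ r → ∀ P x
  → eval (P -ₚ nodeLower A) x + nodeProduct A x ≡ eval P x + x ^ r
eval--nodeLower A refl P x rewrite eval--ₚ P (nodeLower A) x | sym (eval-nodeLower A x) =
  identity (eval P x) (eval (nodeLower A) x) (x ^ length A)
  where
  identity : ∀ p l y → (p - l) + (l + y) ≡ p + y
  identity = solve-∀

eval-+nodeLower-∈ : ∀ {r a} A → length A ≡ r → a ∈ A → ∀ P → eval (P +ₚ nodeLower A) a + a ^ r ≡ eval P a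
eval-+nodeLower-∈ {r} {a} A lenA a∈A P = begin
  eval (P +ₚ nodeLower A) a + a ^ r  ≡⟨ eval-+nodeLower A lenA P a ⟩
  eval P a + nodeProduct A a         ≡⟨ cong (λ t → eval P a + t) (nodeProduct-root A a∈A) ⟩
  eval P a + 0ℤ                      ≡⟨ ℤ.+-identityʳ (eval P a) ⟩
  eval P a                           ∎
  where open ≡-Reasoning

eval--nodeLower-∈ : ∀ {r a} A → length A ≡ r → a ∈ A → ∀ P → eval (P -ₚ nodeLower A) a ≡ eval P a + a ^ r
eval--nodeLower-∈ {r} {a} A lenA a∈A P = begin
  eval (P -ₚ nodeLower A) a                   ≡⟨ ℤ.+-identityʳ _ ⟨
  eval (P -ₚ nodeLower A) a + 0ℤ              ≡⟨ cong (λ t → eval (P -ₚ nodeLower A) a + t) (nodeProduct-root A a∈A) ⟨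
  eval (P -ₚ nodeLower A) a + nodeProduct A a  ≡⟨ eval--nodeLower A lenA P a ⟩
  eval P a + a ^ r                            ∎
  where open ≡-Reasoning

-- Arithmetic modulo m

∣∧<⇒≡0 : ∀ {m n} → m ∣ℕ n → n < m → n ≡ 0
∣∧<⇒≡0 {n = zero} _ _ = refl
∣∧<⇒≡0 {n = suc _} m∣n n<m = ⊥-elim (>⇒∤ n<m m∣n)

distance< : ∀ {x y n} → x < n → y < n → ∣ + x - + y ∣ < n
distance< {x} {y} x<n y<n = subst (_< _) (cong ∣_∣ (sym (ℤ.[+m]-[+n]≡m⊖n x y)))
  (ℕ.≤-<-trans (ℤ.∣m⊝n∣≤m⊔n x y) (ℕ.⊔-pres-<m x<n y<n))

∣! : ∀ {d n} → 0 < d → d ≤ n → d ∣ℕ n !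
∣! {suc d} _ d≤n = ∣-trans (m∣m*n (d !)) (m≤n⇒m!∣n! d≤n)

coprime-1+! : ∀ {d n} → 0 < d → d ≤ n → Coprime (suc (n !)) d
coprime-1+! {d} {n} d>0 d≤n {i} (i∣1+n! , i∣d) =
  ∣1⇒≡1 (∣m+n∣m⇒∣n (subst (i ∣ℕ_) (ℕ.+-comm 1 (n !)) i∣1+n!) (∣-trans i∣d (∣! d>0 d≤n)))

module Modular (m : ℕ) .{{_ : NonZero m}} where

  Apart : ℤ → ℤ → Set
  Apart a b = ∀ {y} → + m ∣ (a - b) * y → + m ∣ y

  Apart-sym : ∀ {a b} → Apart a b → Apart b a
  Apart-sym {a} {b} apart {y} m∣[b-a]y = apart (subst (+ m ∣_) (identity a b y) (∣m⇒∣-m m∣[b-a]y))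
    where
    identity : ∀ a b y → - ((b - a) * y) ≡ (a - b) * y
    identity = solve-∀

  Separated : List ℤ → Set
  Separated = AllPairs Apart

  vanishes-everywhere : ∀ {A} P → Separated A → length P ≤ length A
    → All (λ a → + m ∣ eval P a) A → ∀ x → + m ∣ eval P x
  vanishes-everywhere [] [] _ [] x = divides 0ℤ refl
  vanishes-everywhere {a ∷ A} P (a#A ∷ sA) lenP (m∣Pa ∷ m∣PA) x =
    subst (+ m ∣_) (sym (eval-divLinear a P x))
      (∣m∣n⇒∣m+n m∣Pa (∣n⇒∣m*n (x - a) (vanishes-everywhere D sA (length-divLinear a P lenP) m∣DA x)))
    where
    D = divLinear a P
    difference : ∀ c → eval P c - eval P a ≡ (c - a) * eval D c
    difference c = trans (cong (_- eval P a) (eval-divLinear a P c)) (identity (eval P a) ((c - a) * eval D c))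
      where
      identity : ∀ u t → (u + t) - u ≡ t
      identity = solve-∀
    quotient-vanishes : ∀ {c} → Apart a c × + m ∣ eval P c → + m ∣ eval D c
    quotient-vanishes {c} (a#c , m∣Pc) =
      Apart-sym {a} {c} a#c (subst (+ m ∣_) (difference c) (∣m∣n⇒∣m-n m∣Pc m∣Pa))
    m∣DA : All (λ c → + m ∣ eval D c) A
    m∣DA = All.zipWith quotient-vanishes (a#A , m∣PA)

  ∣nodeProduct⇒∣1 : ∀ {b A} → All (Apart b) A → + m ∣ nodeProduct A b → + m ∣ 1ℤ
  ∣nodeProduct⇒∣1 [] m∣1 = m∣1
  ∣nodeProduct⇒∣1 (b#a ∷ b#A) m∣ = ∣nodeProduct⇒∣1 b#A (b#a m∣)

  ∣1⇒m≡1 : + m ∣ 1ℤ → m ≡ 1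
  ∣1⇒m≡1 = ∣1⇒≡1 ∘ ∣⇒∣ᵤ

  -- H = P + x^r - ∏_{a ∈ A} (x - a) has degree < r and vanishes on A, hence everywhere,
  -- so m divides (P + x^r - H) (b) = ∏_{a ∈ A} (b - a).
  monic-vanishes⇒∣1 : ∀ {r b A} P → length A ≡ r → Separated (b ∷ A) → length P ≤ r
    → All (λ a → + m ∣ eval P a + a ^ r) (b ∷ A) → + m ∣ 1ℤ
  monic-vanishes⇒∣1 {r} {b} {A} P refl (b#A ∷ sA) lenP (m∣Pb ∷ m∣PA) =
    ∣nodeProduct⇒∣1 b#A (subst (+ m ∣_) (difference (eval--nodeLower A refl P b)) (∣m∣n⇒∣m-n m∣Pb m∣Hb))
    where
    H = P -ₚ nodeLower A
    difference : ∀ {h w u} → h + w ≡ u → u - h ≡ w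
    difference {h} {w} refl = identity h w
      where
      identity : ∀ h w → (h + w) - h ≡ w
      identity = solve-∀
    m∣HA : All (λ a → + m ∣ eval H a) A
    m∣HA = All.tabulate λ a∈A → subst (+ m ∣_) (sym (eval--nodeLower-∈ A refl a∈A P)) (All.lookup m∣PA a∈A)
    m∣Hb : + m ∣ eval H b
    m∣Hb = vanishes-everywhere H sA (length--ₚ P (nodeLower A) lenP (length-nodeLower A)) m∣HA b

  residue : ℤ → ℕ
  residue u = u %ℕ m

  residue<m : ∀ u → residue u < m
  residue<m u = n%ℕd<d u m

  residue-0 : residue 0ℤ ≡ 0
  residue-0 = m<n⇒m%n≡m (>-nonZero⁻¹ m)

  ∣residue- : ∀ u → + m ∣ + residue u - u
  ∣residue- u = divides (- (u /ℕ m)) (begin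
    + residue u - u                                 ≡⟨ cong (λ t → + residue u - t) (a≡a%ℕn+[a/ℕn]*n u m) ⟩
    + residue u - (+ residue u + (u /ℕ m) * + m)     ≡⟨ identity (+ residue u) (u /ℕ m) (+ m) ⟩
    - (u /ℕ m) * + m                                ∎)
    where
    open ≡-Reasoning
    identity : ∀ r d n → r - (r + d * n) ≡ - d * n
    identity = solve-∀

  ∣small⇒≡ : ∀ {x y} → x < m → y < m → + m ∣ + x - + y → x ≡ y
  ∣small⇒≡ {x} {y} x<m y<m m∣x-y =
    ℤ.+-injective (ℤ.i-j≡0⇒i≡j (+ x) (+ y) (ℤ.∣i∣≡0⇒i≡0 (∣∧<⇒≡0 (∣⇒∣ᵤ m∣x-y) (distance< x<m y<m))))

  residue-≡⇒∣ : ∀ u v → residue u ≡ residue v → + m ∣ u - v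
  residue-≡⇒∣ u v eq =
    subst (+ m ∣_) (identity (+ residue u) (+ residue v) u v (cong +_ eq))
      (∣m∣n⇒∣m-n (∣residue- v) (∣residue- u))
    where
    identity : ∀ r s u v → r ≡ s → (s - v) - (r - u) ≡ u - v
    identity r s u v refl = identity′ r u v
      where
      identity′ : ∀ r u v → (r - v) - (r - u) ≡ u - v
      identity′ = solve-∀

  ∣⇒residue-≡ : ∀ u v → + m ∣ u - v → residue u ≡ residue v
  ∣⇒residue-≡ u v m∣u-v = ∣small⇒≡ (residue<m u) (residue<m v)
    (subst (+ m ∣_) (identity (+ residue u) (+ residue v) u v)
      (∣m∣n⇒∣m+n (∣m∣n⇒∣m-n (∣residue- u) (∣residue- v)) m∣u-v))
    where
    identity : ∀ r s u v → ((r - u) - (s - v)) + (u - v) ≡ r - s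
    identity = solve-∀

  residue≡0⇒∣ : ∀ u → residue u ≡ 0 → + m ∣ u
  residue≡0⇒∣ u eq = subst (+ m ∣_) (ℤ.+-identityʳ u) (residue-≡⇒∣ u 0ℤ (trans eq (sym residue-0)))

  reduce : ℕ → List ℤ → List ℕ
  reduce zero _ = []
  reduce (suc k) [] = 0 ∷ reduce k []
  reduce (suc k) (p ∷ P) = residue p ∷ reduce k P

  length-reduce : ∀ k P → length (reduce k P) ≡ k
  length-reduce zero P = refl
  length-reduce (suc k) [] = cong suc (length-reduce k [])
  length-reduce (suc k) (p ∷ P) = cong suc (length-reduce k P)

  reduce<m : ∀ k P → All (_< m) (reduce k P)
  reduce<m zero P = []
  reduce<m (suc k) [] = >-nonZero⁻¹ m ∷ reduce<m k []
  reduce<m (suc k) (p ∷ P) = residue<m p ∷ reduce<m k P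

  eval-reduce : ∀ k P → length P ≤ k → ∀ x → + m ∣ eval (toℤ (reduce k P)) x - eval P x
  eval-reduce zero [] _ x = divides 0ℤ refl
  eval-reduce (suc k) [] _ x =
    subst (+ m ∣_) (identity x (eval (toℤ (reduce k [])) x)) (∣n⇒∣m*n x (eval-reduce k [] z≤n x))
    where
    identity : ∀ x u → x * (u - 0ℤ) ≡ (0ℤ + x * u) - 0ℤ
    identity = solve-∀
  eval-reduce (suc k) (p ∷ P) (s≤s lenP) x =
    subst (+ m ∣_) (identity (+ residue p) p x (eval (toℤ (reduce k P)) x) (eval P x))
      (∣m∣n⇒∣m+n (∣residue- p) (∣n⇒∣m*n x (eval-reduce k P lenP x)))
    where
    identity : ∀ r p x u v → (r - p) + x * (u - v) ≡ (r + x * u) - (p + x * v)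
    identity = solve-∀

  vectors : ℕ → List (List ℕ)
  vectors zero = [ [] ]
  vectors (suc k) = cartesianProductWith _∷_ (upTo m) (vectors k)

  ∈-vectors⁺ : ∀ {c} → All (_< m) c → c ∈ vectors (length c)
  ∈-vectors⁺ [] = here refl
  ∈-vectors⁺ (s<m ∷ c<m) = ∈-cartesianProductWith⁺ _∷_ (∈-upTo⁺ s<m) (∈-vectors⁺ c<m)

  ∈-vectors⁻ : ∀ k {c} → c ∈ vectors k → length c ≡ k
  ∈-vectors⁻ zero (here refl) = refl
  ∈-vectors⁻ (suc k) c∈ with ∈-cartesianProductWith⁻ _∷_ (upTo m) (vectors k) c∈
  ... | _ , c′ , _ , c′∈ , refl = cong suc (∈-vectors⁻ k c′∈)

  module Family (r : ℕ) (shift : ℤ → ℤ) where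

    polyValue : List ℤ → ℕ → ℤ
    polyValue P x = eval P (+ x) + shift (+ x)

    polyRow : List ℤ → ℕ → ℕ
    polyRow P x = residue (polyValue P x)

    family : List (ℕ → ℕ)
    family = map (polyRow ∘ toℤ) (vectors r)

    ∈-family⁻ : ∀ {ρ} → ρ ∈ family → ∃[ P ] length P ≤ r × ρ ≡ polyRow P
    ∈-family⁻ ρ∈ with ∈-map⁻ (polyRow ∘ toℤ) ρ∈
    ... | c , c∈ , refl = toℤ c , ℕ.≤-reflexive (trans (length-toℤ c) (∈-vectors⁻ r c∈)) , refl

    polyValue-difference : ∀ P Q x → polyValue P x - polyValue Q x ≡ eval P (+ x) - eval Q (+ x)
    polyValue-difference P Q x = identity (eval P (+ x)) (eval Q (+ x)) (shift (+ x))
      where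
      identity : ∀ u v s → (u + s) - (v + s) ≡ u - v
      identity = solve-∀

    ∈-family⁺ : ∀ P → length P ≤ r → ∃[ ρ ] ρ ∈ family × (∀ x → ρ x ≡ polyRow P x)
    ∈-family⁺ P lenP = polyRow (toℤ c) , ∈-map⁺ (polyRow ∘ toℤ) c∈ , agrees
      where
      c = reduce r P
      c∈ : c ∈ vectors r
      c∈ = subst (λ k → c ∈ vectors k) (length-reduce r P) (∈-vectors⁺ (reduce<m r P))
      agrees : ∀ x → polyRow (toℤ c) x ≡ polyRow P x
      agrees x = ∣⇒residue-≡ (polyValue (toℤ c) x) (polyValue P x)
        (subst (+ m ∣_) (sym (polyValue-difference (toℤ c) P x)) (eval-reduce r P lenP (+ x)))

    packing : ∀ {ρ ρ′ C} → ρ ∈ family → ρ′ ∈ family → Separated (toℤ C) → length C ≡ r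
      → Agree ρ ρ′ C → ∀ x → ρ x ≡ ρ′ x
    packing {C = C} ρ∈ ρ′∈ sep lenC agree x with ∈-family⁻ ρ∈ | ∈-family⁻ ρ′∈
    ... | P , lenP , refl | Q , lenQ , refl =
      ∣⇒residue-≡ (polyValue P x) (polyValue Q x) (subst (+ m ∣_) (sym (difference x))
        (vanishes-everywhere (P -ₚ Q) sep lenP-Q m∣at-C (+ x)))
      where
      difference : ∀ x → polyValue P x - polyValue Q x ≡ eval (P -ₚ Q) (+ x)
      difference x = trans (polyValue-difference P Q x) (sym (eval--ₚ P Q (+ x)))
      lenP-Q : length (P -ₚ Q) ≤ length (toℤ C)
      lenP-Q = subst (length (P -ₚ Q) ≤_) (sym (trans (length-toℤ C) lenC)) (length--ₚ P Q lenP lenQ)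
      m∣at-C : All (λ a → + m ∣ eval (P -ₚ Q) a) (toℤ C)
      m∣at-C = All.map⁺ (All.map (λ {c} eq →
        subst (+ m ∣_) (difference c) (residue-≡⇒∣ (polyValue P c) (polyValue Q c) eq)) agree)

module PolynomialDesign (X : List ℕ) (r : ℕ) where

  N m : ℕ
  N = bound X
  m = suc (N !)

  open Modular m
  module Base = Family r (λ _ → 0ℤ)
  module Shifted = Family r (_^ r)

  apart : ∀ {x y} → x < N → y < N → x ≢ y → Apart (+ x) (+ y)
  apart {x} {y} x<N y<N x≢y {z} m∣ =
    ∣ᵤ⇒∣ (coprime-divisor (+ m) (+ x - + y) z (coprime-1+! d>0 d≤N) (∣⇒∣ᵤ m∣))
    where
    d>0 : 0 < ∣ + x - + y ∣
    d>0 = ℕ.n≢0⇒n>0 (x≢y ∘ ℤ.+-injective ∘ ℤ.i-j≡0⇒i≡j (+ x) (+ y) ∘ ℤ.∣i∣≡0⇒i≡0)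
    d≤N : ∣ + x - + y ∣ ≤ N
    d≤N = ℕ.<⇒≤ (distance< x<N y<N)

  columns-separated : ∀ {k C} → IsColumnSet X k C → Separated (toℤ C)
  columns-separated (uC , _ , C⊆X) = separated uC (All.tabulate (∈⇒<bound ∘ C⊆X))
    where
    separated : ∀ {C} → Unique C → All (_< N) C → Separated (toℤ C)
    separated [] [] = []
    separated {x ∷ C} (x∉C ∷ uC) (x<N ∷ C<N) = All.map⁺ (All.zipWith apart-x (x∉C , C<N)) ∷ separated uC C<N
      where
      apart-x : ∀ {y} → x ≢ y × y < N → Apart (+ x) (+ y)
      apart-x (x≢y , y<N) = apart x<N y<N x≢y

  zeroRow : ∃[ ρ ] ρ ∈ Base.family × Vanishes ρ X
  zeroRow = let ρ , ρ∈ , ρ≗ = Base.∈-family⁺ [] z≤n in ρ , ρ∈ , All.tabulate λ {x} _ → trans (ρ≗ x) residue-0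

  length-nodeLower-columns : ∀ C → length C ≡ r → length (nodeLower (toℤ C)) ≤ r
  length-nodeLower-columns C lenC =
    subst (length (nodeLower (toℤ C)) ≤_) (trans (length-toℤ C) lenC) (length-nodeLower (toℤ C))

  off⇒on : Matching X r Base.family Shifted.family
  off⇒on {C = C} ρ∈ (_ , lenC , _) with Base.∈-family⁻ ρ∈
  ... | P , lenP , refl =
    let L = nodeLower (toℤ C)
        ρ′ , ρ′∈ , ρ′≗ = Shifted.∈-family⁺ (P +ₚ L) (length-+ₚ P L lenP (length-nodeLower-columns C lenC))
    in ρ′ , ρ′∈ , All.tabulate λ {c} c∈C → sym (trans (ρ′≗ c) (cong residue
         (trans (eval-+nodeLower-∈ (toℤ C) (trans (length-toℤ C) lenC) (∈-toℤ⁺ c∈C) P) (sym (ℤ.+-identityʳ _)))))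

  on⇒off : Matching X r Shifted.family Base.family
  on⇒off {C = C} ρ∈ (_ , lenC , _) with Shifted.∈-family⁻ ρ∈
  ... | P , lenP , refl =
    let L = nodeLower (toℤ C)
        ρ′ , ρ′∈ , ρ′≗ = Base.∈-family⁺ (P -ₚ L) (length--ₚ P L lenP (length-nodeLower-columns C lenC))
    in ρ′ , ρ′∈ , All.tabulate λ {c} c∈C → sym (trans (ρ′≗ c) (cong residue
         (trans (ℤ.+-identityʳ _) (eval--nodeLower-∈ (toℤ C) (trans (length-toℤ C) lenC) (∈-toℤ⁺ c∈C) P))))

  on-nonvanishing : ∀ {ρ C} → ρ ∈ Shifted.family → IsColumnSet X (suc r) C → ¬ Vanishes ρ C
  on-nonvanishing {C = []} _ (_ , () , _)
  on-nonvanishing {C = b ∷ C} ρ∈ C-set@(_ , lenC , _) ρ≡0 with Shifted.∈-family⁻ ρ∈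
  ... | P , lenP , refl =
    ℕ.<⇒≢ (ℕ.1≤n! N) (sym (ℕ.suc-injective (∣1⇒m≡1
      (monic-vanishes⇒∣1 P (trans (length-toℤ C) (ℕ.suc-injective lenC)) (columns-separated C-set) lenP
        (All.map⁺ (All.map (λ {x} → residue≡0⇒∣ (Shifted.polyValue P x)) ρ≡0))))))

  design : BoosterDesign X r
  design = record
    { off = Base.family
    ; on = Shifted.family
    ; zeroRow = zeroRow
    ; off-packing = λ ρ∈ ρ′∈ C-set → Base.packing ρ∈ ρ′∈ (columns-separated C-set) (proj₁ (proj₂ C-set))
    ; on-packing = λ ρ∈ ρ′∈ C-set → Shifted.packing ρ∈ ρ′∈ (columns-separated C-set) (proj₁ (proj₂ C-set))
    ; off⇒on = off⇒on
    ; on⇒off = on⇒off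
    ; on-nonvanishing = on-nonvanishing
    }

-- The construction does not need r ≥ 1.
lemma2p4 : (q r : ℕ) → 1 ≤ r → r < q → (X : List ℕ) → IsRSet q X
    → ∃[ B ] IsOrthogonalBooster r q X B
lemma2p4 q r _ r<q X X-set = Rows.Construction.booster r q X-set (PolynomialDesign.design X r) r<q
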